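{- Let $G$ be a finite simple graph, let $H$ be a subgraph of $G$, and let $g,f:V(G)\rightarrow \mathbb{Z}^{+}$ be two functions with $d_H(x)\leq g(x)\leq f(x)\leq d_G(x)$ for each vertex $x\in V(G)$. If $(g(x)-d_H(x))d_G(y)\geq(d_G(x)-d_H(x))f(y)$ holds for any $x,y\in V(G)$, then $G$ has all fractional $(g,f)$-factors including $H$.
   Context: Graphs are finite, undirected, without loops or multiple edges. $\mathbb{Z}^{+}$ denotes the positive integers and $N$ the nonnegative integers. For $x\in V(G)$, $d_G(x)$ is the degree of $x$ in $G$, $d_H(x)$ is the degree of $x$ in $H$ (taken as $0$ if $x\notin V(H)$), and $E(x)$ is the set of edges of $G$ incident with $x$. For $r:V(G)\rightarrow N$, a fractional $r$-factor of $G$ is given by a function $h:E(G)\rightarrow[0,1]$ (its indicator function) with $\sum_{e\in E(x)}h(e)=r(x)$ for every $x\in V(G)$. $G$ has all fractional $(g,f)$-factors including $H$ if for every $r:V(G)\rightarrow N$ with $g(x)\leq r(x)\leq f(x)$ for each $x\in V(G)$, $G$ has a fractional $r$-factor whose indicator function $h$ satisfies $h(e)=1$ for every $e\in E(H)$. -}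

module Defs where

open import Data.Nat using (ℕ; zero; suc; _+_; _*_; _∸_)
import Data.Nat
open import Data.Fin using (Fin; zero; suc)
open import Data.Bool using (Bool; true; false; if_then_else_)
open import Data.Integer using (+_)
open import Data.Rational using (ℚ; 0ℚ; 1ℚ; _≤_; _/_) renaming (_+_ to _+ℚ_)
open import Data.Product using (Σ; _×_)
open import Relation.Binary.PropositionalEquality using (_≡_)

record Graph (n : ℕ) : Set where
  field
    adj    : Fin n → Fin n → Bool
    sym    : ∀ x y → adj x y ≡ adj y x
    irrefl : ∀ x → adj x x ≡ false
open Graph public

record Subgraph {n : ℕ} (G : Graph n) : Set where
  field
    vert      : Fin n → Bool
    hadj      : Fin n → Fin n → Bool
    hsym      : ∀ x y → hadj x y ≡ hadj y x
    hsub      : ∀ x y → hadj x y ≡ true → adj G x y ≡ true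
    hendpoint : ∀ x y → hadj x y ≡ true → vert x ≡ true
open Subgraph public

sumℕ : {n : ℕ} → (Fin n → ℕ) → ℕ
sumℕ {zero}  f = 0
sumℕ {suc n} f = f zero + sumℕ (λ i → f (suc i))

sumℚ : {n : ℕ} → (Fin n → ℚ) → ℚ
sumℚ {zero}  f = 0ℚ
sumℚ {suc n} f = f zero +ℚ sumℚ (λ i → f (suc i))

dG : {n : ℕ} → Graph n → Fin n → ℕ
dG G x = sumℕ (λ y → if adj G x y then 1 else 0)

-- d_H(x): number of H-edges at x (automatically 0 when x ∉ V(H))
dH : {n : ℕ} {G : Graph n} → Subgraph G → Fin n → ℕ
dH H x = sumℕ (λ y → if hadj H x y then 1 else 0)

-- Indicator function of a fractional r-factor: h on edges (encoded as a
-- symmetric function on vertex pairs, only its values on edges matter)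
-- with values in [0,1] on edges and ∑_{e ∈ E(x)} h(e) = r(x).
IsFractionalFactor : {n : ℕ} → (G : Graph n) → (Fin n → ℕ) → (Fin n → Fin n → ℚ) → Set
IsFractionalFactor G r h =
  (∀ x y → h x y ≡ h y x) ×
  (∀ x y → adj G x y ≡ true → (0ℚ ≤ h x y) × (h x y ≤ 1ℚ)) ×
  (∀ x → sumℚ (λ y → if adj G x y then h x y else 0ℚ) ≡ (+ r x) / 1)

AllFractionalFactorsIncluding : {n : ℕ} → (G : Graph n) → Subgraph G → (Fin n → ℕ) → (Fin n → ℕ) → Set
AllFractionalFactorsIncluding {n} G H g f =
  (r : Fin n → ℕ) → (∀ x → g x Data.Nat.≤ r x) → (∀ x → r x Data.Nat.≤ f x) →
  Σ (Fin n → Fin n → ℚ) λ h →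
    IsFractionalFactor G r h × (∀ x y → hadj H x y ≡ true → h x y ≡ 1ℚ)

-- Taking x = y in the hypothesis gives f(x) d_G(x) ≤ g(x) d_G(x), so g = f and every
-- admissible r equals f. The hypothesis for (x, y) and (y, x) then makes r(x)/d_G(x)
-- a constant, equal to 1 as soon as some vertex has d_H(x) ≥ 1, because there the
-- hypothesis at (x, x) forces r(x) = d_G(x). So the weight h(xy) = r(x)/d_G(x), the same
-- on every edge, is a fractional r-factor which is 1 on the edges of H.
module Submission where

open import Defs hiding (sym)
open import Data.Nat using (ℕ; _≤_; _*_; _∸_)
open import Data.Fin using (Fin)
open import Data.Product using (_×_)

open import Data.Nat using (zero; suc; _+_; _<_; z≤n; s≤s; NonZero; >-nonZero)
open import Data.Nat.Properties
open import Data.Fin using () renaming (zero to fzero; suc to fsuc)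
open import Data.Bool using (Bool; true; false; if_then_else_)
open import Data.Integer as ℤ using (+_)
import Data.Integer.Properties as ℤ
open import Data.Rational as ℚ using (ℚ; 0ℚ; 1ℚ; _/_; toℚᵘ)
import Data.Rational.Properties as ℚ
open import Data.Rational.Unnormalised as ℚᵘ using (*≡*; *≤*)
import Data.Rational.Unnormalised.Properties as ℚᵘ
open import Data.Product using (Σ; _,_; proj₁; proj₂)
open import Function using (_∘_)
open import Relation.Binary.PropositionalEquality

[m∸n]*o+n*o≡m*o : ∀ {m n} o → n ≤ m → (m ∸ n) * o + n * o ≡ m * o
[m∸n]*o+n*o≡m*o {m} {n} o n≤m =
  trans (sym (*-distribʳ-+ o (m ∸ n) n)) (cong (_* o) (m∸n+n≡m n≤m))

∸-cross-≤⇒cross-≤ : ∀ {e g d a d′} → e ≤ g → e ≤ d → a ≤ d′ →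
                    (d ∸ e) * a ≤ (g ∸ e) * d′ → a * d ≤ g * d′
∸-cross-≤⇒cross-≤ {e} {g} {d} {a} {d′} e≤g e≤d a≤d′ hyp = begin
  a * d                  ≡⟨ *-comm a d ⟩
  d * a                  ≡⟨ [m∸n]*o+n*o≡m*o a e≤d ⟨
  (d ∸ e) * a + e * a    ≤⟨ +-mono-≤ hyp (*-monoʳ-≤ e a≤d′) ⟩
  (g ∸ e) * d′ + e * d′  ≡⟨ [m∸n]*o+n*o≡m*o d′ e≤g ⟩
  g * d′                 ∎
  where open ≤-Reasoning

∸-self-cross-≤⇒≤ : ∀ {e a d} → 0 < e → e ≤ a → e ≤ d →
                   (d ∸ e) * a ≤ (a ∸ e) * d → d ≤ a
∸-self-cross-≤⇒≤ {e@(suc _)} {a} {d} _ e≤a e≤d hyp =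
  *-cancelˡ-≤ e (+-cancelˡ-≤ ((a ∸ e) * d) (e * d) (e * a) (begin
    (a ∸ e) * d + e * d  ≡⟨ [m∸n]*o+n*o≡m*o d e≤a ⟩
    a * d                ≡⟨ *-comm a d ⟩
    d * a                ≡⟨ [m∸n]*o+n*o≡m*o a e≤d ⟨
    (d ∸ e) * a + e * a  ≤⟨ +-monoˡ-≤ (e * a) hyp ⟩
    (a ∸ e) * d + e * a  ∎))
  where open ≤-Reasoning

toℚᵘ-/ : ∀ i d .{{_ : NonZero d}} → toℚᵘ (i / d) ℚᵘ.≃ i ℚᵘ./ d
toℚᵘ-/ i (suc k) = ℚ.toℚᵘ-fromℚᵘ (i ℚᵘ./ suc k)

/-cross-cong : ∀ a b c d .{{_ : NonZero c}} .{{_ : NonZero d}} →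
               a * d ≡ b * c → + a / c ≡ + b / d
/-cross-cong a b c@(suc _) d@(suc _) eq = ℚ.toℚᵘ-injective
  (ℚᵘ.≃-trans (toℚᵘ-/ (+ a) c) (ℚᵘ.≃-trans (*≡* eqℤ) (ℚᵘ.≃-sym (toℚᵘ-/ (+ b) d))))
  where
  eqℤ : + a ℤ.* + d ≡ + b ℤ.* + c
  eqℤ = trans (sym (ℤ.pos-* a d)) (trans (cong +_ eq) (ℤ.pos-* b c))

/-cross-mono-≤ : ∀ a b c d .{{_ : NonZero c}} .{{_ : NonZero d}} →
                 a * d ≤ b * c → + a / c ℚ.≤ + b / d
/-cross-mono-≤ a b c@(suc _) d@(suc _) le = ℚ.toℚᵘ-cancel-≤
  (ℚᵘ.≤-respˡ-≃ (ℚᵘ.≃-sym (toℚᵘ-/ (+ a) c)) (ℚᵘ.≤-respʳ-≃ (ℚᵘ.≃-sym (toℚᵘ-/ (+ b) d)) (*≤* leℤ)))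
  where
  leℤ : + a ℤ.* + d ℤ.≤ + b ℤ.* + c
  leℤ = subst₂ ℤ._≤_ (ℤ.pos-* a d) (ℤ.pos-* b c) (ℤ.+≤+ le)

i/d+j/d≃[i+j]/d : ∀ i j d .{{_ : NonZero d}} → (i ℚᵘ./ d) ℚᵘ.+ (j ℚᵘ./ d) ℚᵘ.≃ (i ℤ.+ j) ℚᵘ./ d
i/d+j/d≃[i+j]/d i j d@(suc _) = ℚᵘ.≃-trans
  (ℚᵘ.≃-reflexive (ℚᵘ./-cong (sym (ℤ.*-distribʳ-+ (+ d) i j)) refl))
  (ℚᵘ.*-cancelʳ-/ d)

a/d+b/d≡[a+b]/d : ∀ a b d .{{_ : NonZero d}} → + a / d ℚ.+ + b / d ≡ + (a + b) / d
a/d+b/d≡[a+b]/d a b d = ℚ.toℚᵘ-injective (begin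
  toℚᵘ (+ a / d ℚ.+ + b / d)             ≈⟨ ℚ.toℚᵘ-homo-+ (+ a / d) (+ b / d) ⟩
  toℚᵘ (+ a / d) ℚᵘ.+ toℚᵘ (+ b / d)     ≈⟨ ℚᵘ.+-cong (toℚᵘ-/ (+ a) d) (toℚᵘ-/ (+ b) d) ⟩
  (+ a ℚᵘ./ d) ℚᵘ.+ (+ b ℚᵘ./ d)         ≈⟨ i/d+j/d≃[i+j]/d (+ a) (+ b) d ⟩
  + (a + b) ℚᵘ./ d                       ≈⟨ toℚᵘ-/ (+ (a + b)) d ⟨
  toℚᵘ (+ (a + b) / d)                   ∎)
  where open ℚᵘ.≃-Reasoning

count : ∀ {m} → (Fin m → Bool) → ℕ
count b = sumℕ (λ y → if b y then 1 else 0)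

count-pos : ∀ {m} (b : Fin m → Bool) y → b y ≡ true → 0 < count b
count-pos b fzero    by≡true rewrite by≡true = s≤s z≤n
count-pos b (fsuc y) by≡true =
  <-≤-trans (count-pos (b ∘ fsuc) y by≡true) (m≤n+m _ (if b fzero then 1 else 0))

sumℚ-indicator : ∀ {m} (b : Fin m → Bool) a d .{{_ : NonZero d}} →
                 sumℚ (λ y → if b y then + a / d else 0ℚ) ≡ + (count b * a) / d
sumℚ-indicator {zero}  b a d = /-cross-cong 0 0 1 d refl
sumℚ-indicator {suc m} b a d with b fzero
... | true  = trans (cong (+ a / d ℚ.+_) (sumℚ-indicator (b ∘ fsuc) a d))
                    (a/d+b/d≡[a+b]/d a (count (b ∘ fsuc) * a) d)
... | false = trans (ℚ.+-identityˡ _) (sumℚ-indicator (b ∘ fsuc) a d)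

module _ {V : Set} {d e r : V → ℕ} (e≤r : ∀ x → e x ≤ r x) (r≤d : ∀ x → r x ≤ d x)
         (condition : ∀ x y → (d x ∸ e x) * r y ≤ (r x ∸ e x) * d y) where

  private
    e≤d : ∀ x → e x ≤ d x
    e≤d x = ≤-trans (e≤r x) (r≤d x)

  condition⇒proportional : ∀ x y → r x * d y ≡ r y * d x
  condition⇒proportional x y = ≤-antisym (cross y x) (cross x y)
    where
    cross : ∀ x y → r y * d x ≤ r x * d y
    cross x y = ∸-cross-≤⇒cross-≤ (e≤r x) (e≤d x) (r≤d y) (condition x y)

  condition⇒saturated : ∀ x → 0 < e x → r x ≡ d x
  condition⇒saturated x e>0 =
    ≤-antisym (r≤d x) (∸-self-cross-≤⇒≤ e>0 (e≤r x) (e≤d x) (condition x x))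

proportional⇒factorIncluding :
  ∀ {n} (G : Graph n) (H : Subgraph G) (r : Fin n → ℕ) →
  (∀ x → 0 < dG G x) → (∀ x → r x ≤ dG G x) →
  (∀ x y → r x * dG G y ≡ r y * dG G x) →
  (∀ x → 0 < dH H x → r x ≡ dG G x) →
  Σ (Fin n → Fin n → ℚ) λ h →
    IsFractionalFactor G r h × (∀ x y → hadj H x y ≡ true → h x y ≡ 1ℚ)
proportional⇒factorIncluding G H r d>0 r≤d proportional saturated =
  h , (h-sym , h-bounds , h-sum) , h-on-H
  where
  instance
    d≢0 : ∀ {x} → NonZero (dG G x)
    d≢0 = >-nonZero (d>0 _)

  h : _ → _ → ℚ
  h x _ = + r x / dG G x

  h-sym : ∀ x y → h x y ≡ h y x
  h-sym x y = /-cross-cong (r x) (r y) (dG G x) (dG G y) (proportional x y)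

  h-bounds : ∀ x y → adj G x y ≡ true → (0ℚ ℚ.≤ h x y) × (h x y ℚ.≤ 1ℚ)
  h-bounds x _ _ =
    /-cross-mono-≤ 0 (r x) 1 (dG G x) z≤n ,
    /-cross-mono-≤ (r x) 1 (dG G x) 1
      (subst₂ _≤_ (sym (*-identityʳ (r x))) (sym (*-identityˡ (dG G x))) (r≤d x))

  h-sum : ∀ x → sumℚ (λ y → if adj G x y then h x y else 0ℚ) ≡ + r x / 1
  h-sum x = trans (sumℚ-indicator (adj G x) (r x) (dG G x))
                  (/-cross-cong (dG G x * r x) (r x) (dG G x) 1
                    (trans (*-identityʳ _) (*-comm (dG G x) (r x))))

  h-on-H : ∀ x y → hadj H x y ≡ true → h x y ≡ 1ℚ
  h-on-H x y xy∈H = /-cross-cong (r x) 1 (dG G x) 1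
    (trans (*-identityʳ (r x)) (trans (saturated x (count-pos (hadj H x) y xy∈H)) (sym (*-identityˡ _))))

theorem5 : (n : ℕ) (G : Graph n) (H : Subgraph G) (g f : Fin n → ℕ) →
    (∀ x → 1 ≤ g x) → (∀ x → 1 ≤ f x) →
    (∀ x → (dH H x ≤ g x) × (g x ≤ f x) × (f x ≤ dG G x)) →
    (∀ x y → (dG G x ∸ dH H x) * f y ≤ (g x ∸ dH H x) * dG G y) →
    AllFractionalFactorsIncluding G H g f
theorem5 n G H g f _ f≥1 bounds condition r g≤r r≤f =
  proportional⇒factorIncluding G H r d>0 r≤d
    (condition⇒proportional e≤r r≤d condition-r) (condition⇒saturated e≤r r≤d condition-r)
  where
  d e : Fin n → ℕ
  d = dG G
  e = dH H
  e≤g : ∀ x → e x ≤ g x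
  e≤g x = proj₁ (bounds x)
  f≤d : ∀ x → f x ≤ d x
  f≤d x = proj₂ (proj₂ (bounds x))
  d>0 : ∀ x → 0 < d x
  d>0 x = ≤-trans (f≥1 x) (f≤d x)
  r≤d : ∀ x → r x ≤ d x
  r≤d x = ≤-trans (r≤f x) (f≤d x)

  f≤g : ∀ x → f x ≤ g x
  f≤g x = *-cancelʳ-≤ (f x) (g x) (d x) {{>-nonZero (d>0 x)}}
    (∸-cross-≤⇒cross-≤ (e≤g x) (≤-trans (e≤g x) (≤-trans (g≤r x) (r≤d x))) (f≤d x) (condition x x))
  r≡f : ∀ x → r x ≡ f x
  r≡f x = ≤-antisym (r≤f x) (≤-trans (f≤g x) (g≤r x))
  r≡g : ∀ x → r x ≡ g x
  r≡g x = ≤-antisym (≤-trans (r≤f x) (f≤g x)) (g≤r x)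

  e≤r : ∀ x → e x ≤ r x
  e≤r x = subst (e x ≤_) (sym (r≡g x)) (e≤g x)
  condition-r : ∀ x y → (d x ∸ e x) * r y ≤ (r x ∸ e x) * d y
  condition-r x y = subst₂ (λ a b → (d x ∸ e x) * a ≤ (b ∸ e x) * d y)
                           (sym (r≡f y)) (sym (r≡g x)) (condition x y)
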